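{- Let $A$ be an extended process, $x$ a variable, and $\delta_1,\delta_2$ static formulas. If $x$ is minimally secret with respect to $\delta_1$ in $A$ and minimally secret with respect to $\delta_2$ in $A$, then $x$ is minimally secret with respect to $\delta_1\wedge\delta_2$ in $A$.
   Context: Applied pi calculus (Abadi–Fournet) over a signature $\Sigma$ with an equational theory; extended processes with active substitutions; $\mathrm{dom}(A)$ the variables with an unrestricted active substitution; frames $\mathrm{fr}(A)$; traces $\mathbf{tr}=A_0\xRightarrow{\mu_1}\cdots\xRightarrow{\mu_n}A_n$ (closed $A_i$, $\mathrm{fv}(\mu_i)\subseteq\mathrm{dom}(A_{i-1})$), $\mathrm{tr}(A)$ the set of traces, $\mathbf{tr}[i]=A_i$, $\mathbf{tr}[0,i]$ the prefix; $\sim_t$: same labels and pointwise static equivalence. Epistemic logic: static formulas $\delta::=\top\mid M_1=M_2\mid M\in\mathrm{dom}\mid\delta_1\vee\delta_2\mid\neg\delta$; modal formulas add $\langle\mu\rangle_-\varphi$, $F\varphi$, $K\varphi$. For $\rho$ assigning ground terms to $\mathrm{fv}(A)\setminus\mathrm{dom}(A)$, $\mathbf{tr}\in\mathrm{tr}(A\rho)$, $0\le i\le|\mathbf{tr}|$: $M_1=M_2$ holds iff $(M_1\rho=M_2\rho)\mathrm{fr}(\mathbf{tr}[i])$ (equality modulo $\Sigma$ after applying the frame's substitution, restricted names not occurring in $M_1,M_2$); $M\in\mathrm{dom}$ iff $M$ is a variable of $\mathrm{dom}(\mathbf{tr}[i])$; connectives classical; $\langle\mu\rangle_-\varphi$ iff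 the step into $i$ has label $\mu$ and $\varphi$ holds at $i-1$; $F\varphi$ iff $\varphi$ holds at some $j\ge i$; $K\varphi$ iff $\varphi$ holds at $(A,\rho',\mathbf{tr}',i)$ for all $\rho'$ and all $\mathbf{tr}'\in\mathrm{tr}(A\rho')$ with $\mathbf{tr}[0,i]\sim_t\mathbf{tr}'[0,i]$. Extra free variables universally quantified over closed terms. $A\models\varphi$ iff $A,\rho,\mathbf{tr},0\models\varphi$ for all $\rho$ and $\mathbf{tr}\in\mathrm{tr}(A\rho)$. $G\varphi:=\neg F\neg\varphi$, $P\varphi:=\neg K\neg\varphi$, $\varphi_1\wedge\varphi_2:=\neg(\neg\varphi_1\vee\neg\varphi_2)$, $\varphi_1\to\varphi_2:=\neg\varphi_1\vee\varphi_2$. $x$ is minimally secret with respect to $\delta$ in $A$ iff $A\models G(\delta(x)\to P(\neg\delta(x)))$. -}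

module Defs where

open import Data.Nat using (ℕ; zero; suc; _≤_; _<_)
open import Data.Product using (Σ; _×_; _,_)
open import Data.Sum using (_⊎_)
open import Data.Unit using () renaming (⊤ to Unit)
open import Relation.Nullary using (¬_)
open import Relation.Binary.PropositionalEquality using (_≡_)

record AppliedPi : Set₁ where
  field
    Var   : Set
    Term  : Set                     -- terms over Σ (names, variables, function symbols)
    Proc  : Set
    Label : Set

    InDom : Proc → Term → Set
    -- (M = N) fr(B) : equality modulo the equational theory after applying
    -- the frame's substitution (restricted names not occurring in M, N)
    FrameEq : Proc → Term → Term → Set
    _≈ₛ_ : Proc → Proc → Set

    -- ρ : assignments of ground terms to fv(A) ∖ dom(A)
    Val : Proc → Set
    _·_ : (A : Proc) → Val A → Proc
    substT : {A : Proc} → Val A → Term → Term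

    -- closing instantiations of the extra free variables of a formula
    -- (universally quantified over closed terms)
    Inst  : Proc → Set
    instT : {A : Proc} → Inst A → Term → Term

    Trace : Proc → Set
    len   : {B : Proc} → Trace B → ℕ
    -- at t i = tr[i]  (meaningful for i ≤ |tr|)
    at    : {B : Proc} → Trace B → ℕ → Proc
    -- lab t k = μ_{k+1}, the label of the step from tr[k] to tr[k+1]
    lab   : {B : Proc} → Trace B → ℕ → Label

module Logic (M : AppliedPi) where
  open AppliedPi M

  infix  6 _≐_
  infixr 4 _∨ₛ_ _∨_

  data Static : Set where
    ⊤ₛ    : Static
    _≐_   : Term → Term → Static
    _∈dom : Term → Static
    _∨ₛ_  : Static → Static → Static
    ¬ₛ_   : Static → Static

  data Formula : Set where
    stat  : Static → Formula
    _∨_   : Formula → Formula → Formula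
    ¬f_   : Formula → Formula
    ⟨_⟩⁻_ : Label → Formula → Formula
    F_    : Formula → Formula
    K_    : Formula → Formula

  _∧ₛ_ : Static → Static → Static
  δ₁ ∧ₛ δ₂ = ¬ₛ ((¬ₛ δ₁) ∨ₛ (¬ₛ δ₂))

  _⇒_ : Formula → Formula → Formula
  φ ⇒ ψ = (¬f φ) ∨ ψ

  G_ : Formula → Formula
  G φ = ¬f (F (¬f φ))

  P_ : Formula → Formula
  P φ = ¬f (K (¬f φ))

  instS : {A : Proc} → Inst A → Static → Static
  instS σ ⊤ₛ = ⊤ₛ
  instS σ (m ≐ n) = instT σ m ≐ instT σ n
  instS σ (m ∈dom) = instT σ m ∈dom
  instS σ (δ ∨ₛ δ') = instS σ δ ∨ₛ instS σ δ'
  instS σ (¬ₛ δ) = ¬ₛ instS σ δ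

  instF : {A : Proc} → Inst A → Formula → Formula
  instF σ (stat δ) = stat (instS σ δ)
  instF σ (φ ∨ ψ) = instF σ φ ∨ instF σ ψ
  instF σ (¬f φ) = ¬f instF σ φ
  instF σ (⟨ μ ⟩⁻ φ) = ⟨ μ ⟩⁻ instF σ φ
  instF σ (F φ) = F instF σ φ
  instF σ (K φ) = K instF σ φ

  PrefixEquiv : {B B' : Proc} → Trace B → Trace B' → ℕ → Set
  PrefixEquiv t t' i =
    (i ≤ len t) × (i ≤ len t') ×
    ((j : ℕ) → j ≤ i → at t j ≈ₛ at t' j) ×
    ((j : ℕ) → j < i → lab t j ≡ lab t' j)

  satS : (A : Proc) → Val A → Proc → Static → Set
  satS A ρ B ⊤ₛ = Unit
  satS A ρ B (m ≐ n) = FrameEq B (substT ρ m) (substT ρ n)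
  satS A ρ B (m ∈dom) = InDom B m
  satS A ρ B (δ ∨ₛ δ') = satS A ρ B δ ⊎ satS A ρ B δ'
  satS A ρ B (¬ₛ δ) = ¬ satS A ρ B δ

  sat : (A : Proc) (ρ : Val A) → Trace (A · ρ) → ℕ → Formula → Set
  sat A ρ t i (stat δ) = satS A ρ (at t i) δ
  sat A ρ t i (φ ∨ ψ) = sat A ρ t i φ ⊎ sat A ρ t i ψ
  sat A ρ t i (¬f φ) = ¬ sat A ρ t i φ
  sat A ρ t i (⟨ μ ⟩⁻ φ) =
    Σ ℕ λ k → (i ≡ suc k) × (lab t k ≡ μ) × sat A ρ t k φ
  sat A ρ t i (F φ) =
    Σ ℕ λ j → (i ≤ j) × (j ≤ len t) × sat A ρ t j φ
  sat A ρ t i (K φ) =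
    (ρ' : Val A) (t' : Trace (A · ρ')) →
    PrefixEquiv t t' i → sat A ρ' t' i φ

  _⊨_ : Proc → Formula → Set
  A ⊨ φ = (σ : Inst A) (ρ : Val A) (t : Trace (A · ρ)) → sat A ρ t 0 (instF σ φ)

  -- x is minimally secret w.r.t. δ(x) in A iff A ⊨ G(δ(x) → P(¬δ(x)))
  -- (x is the distinguished free variable of δ; it only names δ(x).)
  MinimallySecret : Proc → Var → Static → Set
  MinimallySecret A x δ = A ⊨ (G ((stat δ) ⇒ (P (stat (¬ₛ δ)))))

-- If δ₁ ∧ δ₂ held at some point of a trace and the attacker knew it, then δ₁ would hold
-- there and be known as well, contradicting the minimal secrecy of δ₁.
module Submission where

open import Defs
open import Data.Product using (_,_)
open import Data.Sum using (inj₁; inj₂; [_,_])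
open import Relation.Nullary using (¬_)

module _ (M : AppliedPi) where
  open AppliedPi M
  open Logic M

  module _ {A : Proc} where

    K-mono : ∀ φ ψ {ρ t i} →
             (∀ ρ' t' → sat A ρ' t' i φ → sat A ρ' t' i ψ) →
             sat A ρ t i (K φ) → sat A ρ t i (K ψ)
    K-mono φ ψ φ⇒ψ kφ ρ' t' t∼t' = φ⇒ψ ρ' t' (kφ ρ' t' t∼t')

    P-mono : ∀ φ ψ {ρ t i} →
             (∀ ρ' t' → ¬ sat A ρ' t' i ψ → ¬ sat A ρ' t' i φ) →
             sat A ρ t i (P φ) → sat A ρ t i (P ψ)
    P-mono φ ψ ¬ψ⇒¬φ pφ kψ = pφ (K-mono (¬f ψ) (¬f φ) ¬ψ⇒¬φ kψ)

    ⇒-mono : ∀ φ₁ φ₂ ψ₁ ψ₂ {ρ t i} →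
             (¬ sat A ρ t i φ₁ → ¬ sat A ρ t i ψ₁) →
             (sat A ρ t i φ₂ → sat A ρ t i ψ₂) →
             sat A ρ t i (φ₁ ⇒ φ₂) → sat A ρ t i (ψ₁ ⇒ ψ₂)
    ⇒-mono φ₁ φ₂ ψ₁ ψ₂ ¬φ₁⇒¬ψ₁ φ₂⇒ψ₂ =
      [ (λ ¬φ₁ → inj₁ (¬φ₁⇒¬ψ₁ ¬φ₁)) , (λ φ₂ → inj₂ (φ₂⇒ψ₂ φ₂)) ]

    G-mono : ∀ φ ψ {ρ t i} →
             (∀ j → sat A ρ t j φ → sat A ρ t j ψ) →
             sat A ρ t i (G φ) → sat A ρ t i (G ψ)
    G-mono φ ψ φ⇒ψ gφ (j , i≤j , j≤len , ¬ψ) = gφ (j , i≤j , j≤len , λ φ → ¬ψ (φ⇒ψ j φ))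

  -- Stated through refutations because static satisfaction is read constructively:
  -- δ₁ ∧ₛ δ₂ only yields ¬ ¬ δ₁, whereas ¬ δ₁ refutes δ₁ ∧ₛ δ₂ outright.
  RefutationOf_Refutes_In_ : Static → Static → Proc → Set
  RefutationOf δ Refutes δ' In A =
    (σ : Inst A) (ρ : Val A) (B : Proc) →
    ¬ satS A ρ B (instS σ δ) → ¬ satS A ρ B (instS σ δ')

  minimallySecret-antitone : ∀ {A x} δ δ' → RefutationOf δ Refutes δ' In A →
                             MinimallySecret A x δ → MinimallySecret A x δ'
  minimallySecret-antitone {A} δ δ' refute secret σ ρ t =
    G-mono (secrecy δ) (secrecy δ') {ρ} {t} secrecy-at (secret σ ρ t)
    where
    secrecy : Static → Formula
    secrecy θ = instF σ ((stat θ) ⇒ (P (stat (¬ₛ θ))))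

    secrecy-at : ∀ j → sat A ρ t j (secrecy δ) → sat A ρ t j (secrecy δ')
    secrecy-at j =
      ⇒-mono (stat (instS σ δ)) (P neg) (stat (instS σ δ')) (P neg') {ρ} {t}
        (refute σ ρ (at t j))
        (P-mono neg neg' {ρ} {t} λ ρ' t' ¬¬δ' ¬δ → ¬¬δ' (refute σ ρ' (at t' j) ¬δ))
      where
      neg neg' : Formula
      neg = stat (instS σ (¬ₛ δ))
      neg' = stat (instS σ (¬ₛ δ'))

  refutation-refutes-∧ₛ : ∀ {A} δ₁ δ₂ → RefutationOf δ₁ Refutes (δ₁ ∧ₛ δ₂) In A
  refutation-refutes-∧ₛ δ₁ δ₂ σ ρ B ¬δ₁ ¬[¬δ₁∨¬δ₂] = ¬[¬δ₁∨¬δ₂] (inj₁ ¬δ₁)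

proposition4p14 : (M : AppliedPi) (A : AppliedPi.Proc M) (x : AppliedPi.Var M)
    (δ₁ δ₂ : Logic.Static M) →
    Logic.MinimallySecret M A x δ₁ → Logic.MinimallySecret M A x δ₂ →
    Logic.MinimallySecret M A x (Logic._∧ₛ_ M δ₁ δ₂)
proposition4p14 M A x δ₁ δ₂ secret₁ _ =
  minimallySecret-antitone M {A} {x} δ₁ (Logic._∧ₛ_ M δ₁ δ₂)
    (refutation-refutes-∧ₛ M δ₁ δ₂) secret₁
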